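{- For each $n\ge4$, the number of acyclic orientations of $\mathcal{B}_n^\ast$ is $$\left(2^{2^{\frac{n-1}{2}}}-2\right)^4\left(2^{2^{\frac{n+1}{2}}}-2\right)\prod_{i=1}^{\frac{n-1}{2}-1}\left(2^{2^i}-2\right)^{3\cdot 2^{n-2i-1}}$$ for $n$ odd, and $$\left(2^{2^{\frac{n}{2}}}-2\right)^3\prod_{i=1}^{\frac{n}{2}-1}\left(2^{2^i}-2\right)^{3\cdot 2^{n-2i-1}}$$ for $n$ even. Moreover, these numbers are $2$, $2^3$ and $2^5\cdot 7$ for $n=1,2,3$ respectively.
   Context: The Basilica group is generated by the automorphisms $a,b$ of the rooted binary tree defined recursively on finite binary words $w$ by $a(0w)=0\,b(w)$, $a(1w)=1w$, $b(0w)=1\,a(w)$, $b(1w)=0w$. For $n\ge1$, the Schreier graph $\mathcal{B}_n$ is the finite multigraph with vertex set $\{0,1\}^n$ having, for each vertex $u$ and each $s\in\{a,b\}$, one edge joining $u$ and $s(u)$ (a loop if $s(u)=u$); $\mathcal{B}_n^\ast$ is obtained from $\mathcal{B}_n$ by deleting all loops. An orientation assigns a direction to each edge (parallel edges independently); it is acyclic if there is no directed cycle (two parallel edges oriented oppositely form a directed cycle). -}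

module Defs where

open import Data.Bool using (Bool; true; false; if_then_else_)
import Data.Bool.Properties as BoolP
open import Data.Nat using (ℕ; zero; suc; _+_; _*_; _∸_; _^_)
open import Data.Fin using (Fin)
open import Data.List using (List; []; _∷_; _++_; map; concatMap; length; product)
open import Data.List.Membership.Propositional using (_∈_)
open import Data.List.Relation.Unary.Unique.Propositional using (Unique)
open import Data.Vec using (Vec; lookup; fromList) renaming ([] to []ᵥ; _∷_ to _∷ᵥ_)
open import Data.Vec.Properties using (≡-dec)
open import Data.Product using (_×_; _,_; ∃)
open import Relation.Nullary using (¬_; does)
open import Relation.Binary.PropositionalEquality using (_≡_)
open import Relation.Binary.Construct.Closure.Transitive using (TransClosure)
open import Function.Bundles using (_⇔_)

-- Binary words of length n (false = letter 0, true = letter 1)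

Word : ℕ → Set
Word n = Vec Bool n

basA : ∀ {n} → Word n → Word n
basB : ∀ {n} → Word n → Word n
basA []ᵥ            = []ᵥ
basA (false ∷ᵥ w)   = false ∷ᵥ basB w
basA (true  ∷ᵥ w)   = true ∷ᵥ w
basB []ᵥ            = []ᵥ
basB (false ∷ᵥ w)   = true ∷ᵥ basA w
basB (true  ∷ᵥ w)   = false ∷ᵥ w

data Gen : Set where
  gA gB : Gen

act : Gen → ∀ {n} → Word n → Word n
act gA = basA
act gB = basB

allWords : ∀ n → List (Word n)
allWords zero    = []ᵥ ∷ []
allWords (suc n) = map (false ∷ᵥ_) (allWords n) ++ map (true ∷ᵥ_) (allWords n)

-- The loop-free Schreier graph B_n^* as a list of edges (with multiplicity):
-- for each vertex u and each generator s, one edge joining u and s(u),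
-- omitted when s(u) = u (a loop).

schreierEdge : ∀ {n} → Word n → Gen → List (Word n × Word n)
schreierEdge u s =
  if does (≡-dec BoolP._≟_ (act s u) u) then [] else ((u , act s u) ∷ [])

edgesB* : ∀ n → List (Word n × Word n)
edgesB* n = concatMap (λ u → schreierEdge u gA ++ schreierEdge u gB) (allWords n)

numEdges : ℕ → ℕ
numEdges n = length (edgesB* n)

edgeVec : ∀ n → Vec (Word n × Word n) (numEdges n)
edgeVec n = fromList (edgesB* n)

-- Orientations: each edge (independently, also parallel ones) gets a
-- direction; bit true orients edge (u , v) as u → v, false as v → u.

Orientation : ℕ → Set
Orientation n = Vec Bool (numEdges n)

orient : ∀ {n} → (Word n × Word n) → Bool → Word n × Word n
orient (u , v) true  = (u , v)
orient (u , v) false = (v , u)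

Arc : ∀ {n} → Orientation n → Word n → Word n → Set
Arc {n} o x y = ∃ λ (i : Fin (numEdges n)) → orient (lookup (edgeVec n) i) (lookup o i) ≡ (x , y)

HasDirectedCycle : ∀ {n} → Orientation n → Set
HasDirectedCycle {n} o = ∃ λ (x : Word n) → TransClosure (Arc o) x x

Acyclic : ∀ n → Orientation n → Set
Acyclic n o = ¬ HasDirectedCycle {n} o

-- "The number of elements of A satisfying P is N": an explicit
-- duplicate-free list enumerating exactly those elements, of length N.

record HasCount {A : Set} (P : A → Set) (N : ℕ) : Set where
  field
    elems    : List A
    unique   : Unique elems
    complete : ∀ x → (x ∈ elems) ⇔ P x
    size     : length elems ≡ N

NumAcyclicOrientations : ℕ → ℕ → Set
NumAcyclicOrientations n N = HasCount (Acyclic n) N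

prod1 : ℕ → (ℕ → ℕ) → ℕ
prod1 zero    f = 1
prod1 (suc m) f = prod1 m f * f (suc m)

T : ℕ → ℕ
T i = 2 ^ (2 ^ i) ∸ 2

innerProd : (n k : ℕ) → ℕ
innerProd n k = prod1 (k ∸ 1) (λ i → T i ^ (3 * 2 ^ (n ∸ 2 * i ∸ 1)))

oddFormula : ℕ → ℕ
oddFormula k = T k ^ 4 * T (suc k) * innerProd (2 * k + 1) k

evenFormula : ℕ → ℕ
evenFormula k = T k ^ 3 * innerProd (2 * k) k

module Submission where

-- In B_{m+1}^* every vertex 1a(w) has degree two, lying on the b-path
-- 0w — 1a(w) — 0a(w). Contracting these paths leaves a copy of the level-m
-- Schreier graph on the 0-words in which the a-edges are paths of length two,
-- the b-edges single edges, and the a-loops at the 1-words are subdivided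
-- loops. In general one contracts a level-m graph whose a- and b-edges are
-- paths of lengths ℓ and ℓ′: a path acts as a directed arc only when all its
-- edges agree, and a subdivided loop is acyclic only when they do not, which
-- happens for 2^ℓ − 2 of its orientations. Contraction turns the lengths
-- (ℓ, ℓ′) into (2ℓ′, ℓ), so all lengths are powers of two, and an
-- orientation is acyclic iff every loop met along the way is incoherent.
-- Counting the loops of each length gives the product formula.

open import Defs
open import Data.Nat using (ℕ; _+_; _*_; _≤_)
open import Data.Product using (_×_)
open import Relation.Binary.PropositionalEquality using (_≡_)

open import Data.Bool using (Bool; true; false)
import Data.Bool.Properties as Bool
open import Data.Empty using (⊥; ⊥-elim)
open import Data.Fin using (zero; suc)
import Data.List as List
open import Data.List using (List; []; _∷_; length; cartesianProduct)
open import Data.List.Membership.Propositional using (_∈_)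
open import Data.List.Membership.Propositional.Properties
  using (∈-map⁺; ∈-map⁻; ∈-++⁺ˡ; ∈-++⁺ʳ; ∈-++⁻; ∈-cartesianProduct⁺; ∈-cartesianProduct⁻)
import Data.List.Properties as List
import Data.List.Relation.Unary.All as All
import Data.List.Relation.Unary.AllPairs as AllPairs
open import Data.List.Relation.Unary.Any using (here; there)
import Data.List.Relation.Unary.Any.Properties as Any
import Data.List.Relation.Unary.Unique.Propositional.Properties as Unique
open import Data.Nat using (zero; suc; _^_; _∸_; s≤s)
import Data.Nat.Properties as ℕ
open import Data.Nat.Tactic.RingSolver using (solve-∀)
open import Data.Product using (_,_; ∃; Σ; proj₁; proj₂)
open import Data.Product.Function.NonDependent.Propositional using (_×-↔_; _×-⇔_)
import Data.Product.Function.Dependent.Propositional as Σ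
open import Function.Related.Propositional using (equivalence; ≡⇒)
open import Data.Sum using (_⊎_; inj₁; inj₂; [_,_]′; map₂)
open import Data.Sum.Function.Propositional using (_⊎-⇔_)
open import Data.Unit using (⊤; tt)
open import Data.Vec using (Vec; []; _∷_; _++_; take; drop; lookup; fromList)
open import Data.Vec.Properties using (≡-dec; ∷-injectiveʳ; ++-injective; take++drop≡id)
open import Function using (_∘_; case_of_)
open import Function.Bundles using (_⇔_; mk⇔; Equivalence; _↔_; Inverse; mk↔ₛ′; Injection)
import Function.Properties.Equivalence as ⇔
open import Function.Properties.Inverse using (↔-refl; ↔-sym; ↔-trans; ↔⇒⇔; ↔⇒↣)
open import Relation.Binary.Construct.Closure.Transitive as TC using (TransClosure; [_]; _∷_; _∷ʳ_)
open import Relation.Binary.PropositionalEquality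
  using (refl; sym; trans; cong; cong₂; subst; subst₂; module ≡-Reasoning)
open import Relation.Nullary using (¬_)
open import Relation.Nullary.Decidable using (dec-true; dec-false)
open import Relation.Unary using (_⟨×⟩_)

data Dir : Set where
  forward backward blocked : Dir

infixr 5 _⨾_

_⨾_ : Dir → Dir → Dir
forward  ⨾ forward  = forward
backward ⨾ backward = backward
_        ⨾ _        = blocked

⨾-assoc : ∀ d e f → (d ⨾ e) ⨾ f ≡ d ⨾ (e ⨾ f)
⨾-assoc blocked  _        _        = refl
⨾-assoc forward  blocked  _        = refl
⨾-assoc backward blocked  _        = refl
⨾-assoc forward  forward  blocked  = refl
⨾-assoc forward  backward blocked  = refl
⨾-assoc backward forward  blocked  = refl
⨾-assoc backward backward blocked  = refl
⨾-assoc forward  forward  forward  = refl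
⨾-assoc forward  forward  backward = refl
⨾-assoc forward  backward forward  = refl
⨾-assoc forward  backward backward = refl
⨾-assoc backward forward  forward  = refl
⨾-assoc backward forward  backward = refl
⨾-assoc backward backward forward  = refl
⨾-assoc backward backward backward = refl

⨾-forward⁻ : ∀ d e → d ⨾ e ≡ forward → d ≡ forward × e ≡ forward
⨾-forward⁻ forward  forward  _ = refl , refl
⨾-forward⁻ forward  backward ()
⨾-forward⁻ forward  blocked  ()
⨾-forward⁻ backward forward  ()
⨾-forward⁻ backward backward ()
⨾-forward⁻ backward blocked  ()
⨾-forward⁻ blocked  _        ()

⨾-backward⁻ : ∀ d e → d ⨾ e ≡ backward → d ≡ backward × e ≡ backward
⨾-backward⁻ backward backward _ = refl , refl
⨾-backward⁻ forward  forward  ()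
⨾-backward⁻ forward  backward ()
⨾-backward⁻ forward  blocked  ()
⨾-backward⁻ backward forward  ()
⨾-backward⁻ backward blocked  ()
⨾-backward⁻ blocked  _        ()

-- A generalised Schreier graph on Word m: for each vertex w and generator s
-- there is a (possibly subdivided) edge from w to s(w), whose direction is
-- recorded here; a blocked edge carries no directed arc at all.
Directions : ℕ → Set
Directions m = Word m → Gen → Dir

Arrow : ∀ {m} → Directions m → Word m → Word m → Set
Arrow R x y = Σ Gen λ s → (R x s ≡ forward × y ≡ act s x) ⊎ (R y s ≡ backward × x ≡ act s y)

HasCycle : ∀ {m} → Directions m → Set
HasCycle {m} R = ∃ λ (x : Word m) → TransClosure (Arrow R) x x

-- Apart from its a-loop, the vertex 1a(w) lies only on the b-path
-- 0w — 1a(w) — 0a(w), which becomes the a-edge at w; the a-edge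
-- 0w — 0b(w) becomes the b-edge at w.
contract : ∀ {m} → Directions (suc m) → Directions m
contract R w gA = R (false ∷ w) gB ⨾ R (true ∷ basA w) gB
contract R w gB = R (false ∷ w) gA

UnblockedLoop : ∀ {m} → Directions (suc m) → Set
UnblockedLoop {m} R = ∃ λ (w : Word m) → ¬ R (true ∷ w) gA ≡ blocked

LoopsBlocked : ∀ m → Directions m → Set
LoopsBlocked zero    R = R [] gA ≡ blocked × R [] gB ≡ blocked
LoopsBlocked (suc m) R = (∀ w → R (true ∷ w) gA ≡ blocked) × LoopsBlocked m (contract R)

basA-injective : ∀ {m} {x y : Word m} → basA x ≡ basA y → x ≡ y
basB-injective : ∀ {m} {x y : Word m} → basB x ≡ basB y → x ≡ y
basA-injective {x = []}        {[]}        _ = refl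
basA-injective {x = false ∷ x} {false ∷ y} p = cong (false ∷_) (basB-injective (∷-injectiveʳ p))
basA-injective {x = true ∷ x}  {true ∷ y}  p = p
basB-injective {x = []}        {[]}        _ = refl
basB-injective {x = false ∷ x} {false ∷ y} p = cong (false ∷_) (basA-injective (∷-injectiveʳ p))
basB-injective {x = true ∷ x}  {true ∷ y}  p = cong (true ∷_) (∷-injectiveʳ p)

module Contraction {m : ℕ} (R : Directions (suc m)) where

  -- first and second half of a b-path 0w → 1v → 0z, in either direction
  Enter : Word m → Word m → Set
  Enter w v = (R (false ∷ w) gB ≡ forward × v ≡ basA w) ⊎ (R (true ∷ v) gB ≡ backward × v ≡ w)

  Leave : Word m → Word m → Set
  Leave v z = (R (true ∷ v) gB ≡ forward × z ≡ v) ⊎ (R (false ∷ z) gB ≡ backward × v ≡ basA z)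

  arrow-from-0 : ∀ {w y} → Arrow R (false ∷ w) y →
    (∃ λ z → y ≡ false ∷ z × Arrow (contract R) w z) ⊎ (∃ λ v → y ≡ true ∷ v × Enter w v)
  arrow-from-0 {w} (gA , inj₁ (r , refl)) = inj₁ (basB w , refl , gB , inj₁ (r , refl))
  arrow-from-0 {w} (gB , inj₁ (r , refl)) = inj₂ (basA w , refl , inj₁ (r , refl))
  arrow-from-0 {y = false ∷ z} (gA , inj₂ (r , refl)) = inj₁ (z , refl , gB , inj₂ (r , refl))
  arrow-from-0 {y = true ∷ v}  (gB , inj₂ (r , refl)) = inj₂ (v , refl , inj₂ (r , refl))
  arrow-from-0 {y = true ∷ _}  (gA , inj₂ (_ , ()))
  arrow-from-0 {y = false ∷ _} (gB , inj₂ (_ , ()))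

  arrow-from-1 : ∀ {v y} → Arrow R (true ∷ v) y →
    UnblockedLoop R ⊎ (∃ λ z → y ≡ false ∷ z × Leave v z)
  arrow-from-1 {v} (gA , inj₁ (r , refl)) = inj₁ (v , λ e → case trans (sym r) e of λ ())
  arrow-from-1 {v} (gB , inj₁ (r , refl)) = inj₂ (v , refl , inj₁ (r , refl))
  arrow-from-1 {y = true ∷ z}  (gA , inj₂ (r , refl)) = inj₁ (z , λ e → case trans (sym r) e of λ ())
  arrow-from-1 {y = false ∷ z} (gB , inj₂ (r , refl)) = inj₂ (z , refl , inj₂ (r , refl))
  arrow-from-1 {y = false ∷ _} (gA , inj₂ (_ , ()))
  arrow-from-1 {y = true ∷ _}  (gB , inj₂ (_ , ()))

  enter-leave : ∀ {w v z} → Enter w v → Leave v z → Arrow (contract R) w z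
  enter-leave {w} (inj₁ (r₁ , refl)) (inj₁ (r₂ , refl)) = gA , inj₁ (cong₂ _⨾_ r₁ r₂ , refl)
  enter-leave {z = z} (inj₂ (r₁ , refl)) (inj₂ (r₂ , refl)) = gA , inj₂ (cong₂ _⨾_ r₂ r₁ , refl)
  enter-leave (inj₁ (r₁ , refl)) (inj₂ (r₂ , e)) with basA-injective e
  ... | refl with trans (sym r₁) r₂
  ... | ()
  enter-leave (inj₂ (r₁ , refl)) (inj₁ (r₂ , _)) with trans (sym r₂) r₁
  ... | ()

  path-from-0 : ∀ {w z} → TransClosure (Arrow R) (false ∷ w) (false ∷ z) →
    UnblockedLoop R ⊎ TransClosure (Arrow (contract R)) w z
  path-via-1 : ∀ {w v z} → Enter w v → TransClosure (Arrow R) (true ∷ v) (false ∷ z) →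
    UnblockedLoop R ⊎ TransClosure (Arrow (contract R)) w z
  path-from-0 [ r ] with arrow-from-0 r
  ... | inj₁ (_ , refl , r′) = inj₂ [ r′ ]
  ... | inj₂ (_ , () , _)
  path-from-0 (r ∷ rs) with arrow-from-0 r
  ... | inj₁ (_ , refl , r′) = map₂ (r′ ∷_) (path-from-0 rs)
  ... | inj₂ (_ , refl , h) = path-via-1 h rs
  path-via-1 h [ r ] with arrow-from-1 r
  ... | inj₁ l = inj₁ l
  ... | inj₂ (_ , refl , h′) = inj₂ [ enter-leave h h′ ]
  path-via-1 h (r ∷ rs) with arrow-from-1 r
  ... | inj₁ l = inj₁ l
  ... | inj₂ (_ , refl , h′) = map₂ (enter-leave h h′ ∷_) (path-from-0 rs)

  -- A cycle through some 1v is rotated so that it starts at the 0-word after 1v.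
  cycle-contract : HasCycle R → UnblockedLoop R ⊎ HasCycle (contract R)
  cycle-contract (false ∷ w , c) = map₂ (w ,_) (path-from-0 c)
  cycle-contract (true ∷ v , [ r ]) with arrow-from-1 r
  ... | inj₁ l = inj₁ l
  ... | inj₂ (_ , () , _)
  cycle-contract (true ∷ v , r ∷ rs) with arrow-from-1 r
  ... | inj₁ l = inj₁ l
  ... | inj₂ (z , refl , _) = map₂ (z ,_) (path-from-0 (rs ∷ʳ r))

  lift-arrow : ∀ {w z} → Arrow (contract R) w z → TransClosure (Arrow R) (false ∷ w) (false ∷ z)
  lift-arrow (gB , inj₁ (r , refl)) = [ gA , inj₁ (r , refl) ]
  lift-arrow (gB , inj₂ (r , refl)) = [ gA , inj₂ (r , refl) ]
  lift-arrow {w} (gA , inj₁ (r , refl)) with ⨾-forward⁻ (R (false ∷ w) gB) (R (true ∷ basA w) gB) r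
  ... | r₁ , r₂ = (gB , inj₁ (r₁ , refl)) ∷ [ gB , inj₁ (r₂ , refl) ]
  lift-arrow {z = z} (gA , inj₂ (r , refl)) with ⨾-backward⁻ (R (false ∷ z) gB) (R (true ∷ basA z) gB) r
  ... | r₁ , r₂ = (gB , inj₂ (r₂ , refl)) ∷ [ gB , inj₂ (r₁ , refl) ]

  lift-path : ∀ {w z} → TransClosure (Arrow (contract R)) w z → TransClosure (Arrow R) (false ∷ w) (false ∷ z)
  lift-path [ r ]    = lift-arrow r
  lift-path (r ∷ rs) = lift-arrow r TC.++ lift-path rs

  lift-cycle : HasCycle (contract R) → HasCycle R
  lift-cycle (w , c) = false ∷ w , lift-path c

loopsBlocked⇔acyclic : ∀ m (R : Directions m) → LoopsBlocked m R ⇔ (¬ HasCycle R)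
loopsBlocked⇔acyclic zero R = mk⇔ noCycle blockedLoops
  where
  blocked-at : LoopsBlocked zero R → ∀ s → R [] s ≡ blocked
  blocked-at (ra , _) gA = ra
  blocked-at (_ , rb) gB = rb
  noArrow : LoopsBlocked zero R → ∀ {y} → ¬ Arrow R [] y
  noArrow loops      (s , inj₁ (r , _)) = case trans (sym r) (blocked-at loops s) of λ ()
  noArrow loops {[]} (s , inj₂ (r , _)) = case trans (sym r) (blocked-at loops s) of λ ()
  noCycle : LoopsBlocked zero R → ¬ HasCycle R
  noCycle loops ([] , [ r ]) = noArrow loops r
  noCycle loops ([] , r ∷ _) = noArrow loops r
  act-[] : ∀ s → [] ≡ act s []
  act-[] gA = refl
  act-[] gB = refl
  blockedLoops : ¬ HasCycle R → LoopsBlocked zero R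
  blockedLoops nc = loop gA , loop gB
    where
    loop : ∀ s → R [] s ≡ blocked
    loop s with R [] s in eq
    ... | forward  = ⊥-elim (nc ([] , [ s , inj₁ (eq , act-[] s) ]))
    ... | backward = ⊥-elim (nc ([] , [ s , inj₂ (eq , act-[] s) ]))
    ... | blocked  = refl
loopsBlocked⇔acyclic (suc m) R = mk⇔ noCycle blockedLoops
  where
  open Contraction R
  IH : LoopsBlocked m (contract R) ⇔ (¬ HasCycle (contract R))
  IH = loopsBlocked⇔acyclic m (contract R)
  noCycle : LoopsBlocked (suc m) R → ¬ HasCycle R
  noCycle (loops , rest) c with cycle-contract c
  ... | inj₁ (w , unblocked) = unblocked (loops w)
  ... | inj₂ c′ = Equivalence.to IH rest c′
  blockedLoops : ¬ HasCycle R → LoopsBlocked (suc m) R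
  blockedLoops nc = loop , Equivalence.from IH (nc ∘ lift-cycle)
    where
    loop : ∀ w → R (true ∷ w) gA ≡ blocked
    loop w with R (true ∷ w) gA in eq
    ... | forward  = ⊥-elim (nc (true ∷ w , [ gA , inj₁ (eq , refl) ]))
    ... | backward = ⊥-elim (nc (true ∷ w , [ gA , inj₂ (eq , refl) ]))
    ... | blocked  = refl

loopsBlocked-≗ : ∀ m {R R′ : Directions m} → (∀ w s → R w s ≡ R′ w s) →
  LoopsBlocked m R ⇔ LoopsBlocked m R′
loopsBlocked-≗ m R≗R′ = mk⇔ (transport m R≗R′) (transport m (λ w s → sym (R≗R′ w s)))
  where
  transport : ∀ m {R R′ : Directions m} → (∀ w s → R w s ≡ R′ w s) → LoopsBlocked m R → LoopsBlocked m R′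
  transport zero    R≗R′ (ra , rb) = trans (sym (R≗R′ [] gA)) ra , trans (sym (R≗R′ [] gB)) rb
  transport (suc m) R≗R′ (loops , rest) =
    (λ w → trans (sym (R≗R′ (true ∷ w) gA)) (loops w)) , transport m contract-≗ rest
    where
    contract-≗ : ∀ w s → contract _ w s ≡ contract _ w s
    contract-≗ w gA = cong₂ _⨾_ (R≗R′ (false ∷ w) gB) (R≗R′ (true ∷ basA w) gB)
    contract-≗ w gB = R≗R′ (false ∷ w) gA

-- Counting

module _ {A B : Set} {P : A → Set} {Q : B → Set} where

  count-image : ∀ {N} (e : A ↔ B) → (∀ a → P a ⇔ Q (Inverse.to e a)) → HasCount P N → HasCount Q N
  count-image e P⇔Q h = record
    { elems    = List.map to elems
    ; unique   = Unique.map⁺ (Injection.injective (↔⇒↣ e)) unique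
    ; complete = λ b → mk⇔ (image⇒Q b) (Q⇒image b)
    ; size     = trans (List.length-map to elems) size
    }
    where
    open HasCount h
    open Inverse e
    image⇒Q : ∀ b → b ∈ List.map to elems → Q b
    image⇒Q b b∈ with ∈-map⁻ to b∈
    ... | a , a∈ , refl = Equivalence.to (P⇔Q a) (Equivalence.to (complete a) a∈)
    Q⇒image : ∀ b → Q b → b ∈ List.map to elems
    Q⇒image b q = subst (_∈ List.map to elems) (strictlyInverseˡ b)
      (∈-map⁺ to (Equivalence.from (complete (from b))
        (Equivalence.from (P⇔Q (from b)) (subst Q (sym (strictlyInverseˡ b)) q))))

  count-× : ∀ {N M} → HasCount P N → HasCount Q M → HasCount (P ⟨×⟩ Q) (N * M)
  count-× hP hQ = record
    { elems    = cartesianProduct (elems hP) (elems hQ)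
    ; unique   = Unique.cartesianProduct⁺ (unique hP) (unique hQ)
    ; complete = λ { (a , b) → mk⇔
        (λ ab∈ → let a∈ , b∈ = ∈-cartesianProduct⁻ (elems hP) (elems hQ) ab∈
                 in Equivalence.to (complete hP a) a∈ , Equivalence.to (complete hQ b) b∈)
        (λ (pa , qb) → ∈-cartesianProduct⁺ (Equivalence.from (complete hP a) pa)
                                            (Equivalence.from (complete hQ b) qb)) }
    ; size     = trans (length-cartesianProduct (elems hP) (elems hQ)) (cong₂ _*_ (size hP) (size hQ))
    }
    where
    open HasCount
    length-cartesianProduct : ∀ (xs : List A) (ys : List B) → length (cartesianProduct xs ys) ≡ length xs * length ys
    length-cartesianProduct []       ys = refl
    length-cartesianProduct (x ∷ xs) ys = trans (List.length-++ (List.map (x ,_) ys))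
      (cong₂ _+_ (List.length-map (x ,_) ys) (length-cartesianProduct xs ys))

count-preimage : ∀ {A B : Set} {P : A → Set} {Q : B → Set} {N} (e : B ↔ A) →
  (∀ b → Q b ⇔ P (Inverse.to e b)) → HasCount P N → HasCount Q N
count-preimage {P = P} {Q} e Q⇔P = count-image (↔-sym e) λ a →
  mk⇔ (λ p → Equivalence.from (Q⇔P (from a)) (subst P (sym (strictlyInverseˡ a)) p))
      (λ q → subst P (strictlyInverseˡ a) (Equivalence.to (Q⇔P (from a)) q))
  where open Inverse e

count-∅ : ∀ {A : Set} → HasCount {A} (λ _ → ⊥) 0
count-∅ = record { elems = [] ; unique = AllPairs.[] ; complete = λ _ → mk⇔ (λ ()) (λ ()) ; size = refl }

count-Vec-∷ : ∀ {k} {P : Vec Bool (suc k) → Set} {P₁ P₀ : Vec Bool k → Set} {N M} →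
  HasCount P₁ N → HasCount P₀ M →
  (∀ v → P₁ v ⇔ P (true ∷ v)) → (∀ v → P₀ v ⇔ P (false ∷ v)) → HasCount P (N + M)
count-Vec-∷ {k} {P} h₁ h₀ e₁ e₀ = record
  { elems    = E₁ List.++ E₀
  ; unique   = Unique.++⁺ (Unique.map⁺ ∷-injectiveʳ (unique h₁)) (Unique.map⁺ ∷-injectiveʳ (unique h₀))
                          disjoint
  ; complete = λ v → mk⇔ (E⇒P v) (P⇒E v)
  ; size     = trans (List.length-++ E₁) (cong₂ _+_ (trans (List.length-map _ (elems h₁)) (size h₁))
                                                   (trans (List.length-map _ (elems h₀)) (size h₀)))
  }
  where
  open HasCount
  E₁ E₀ : List (Vec Bool (suc k))
  E₁ = List.map (true ∷_) (elems h₁)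
  E₀ = List.map (false ∷_) (elems h₀)
  ∈-map-∷⁻ : ∀ {b c u} {E : List (Vec Bool k)} → b ∷ u ∈ List.map (c ∷_) E → b ≡ c × u ∈ E
  ∈-map-∷⁻ {c = c} b∷u∈ with ∈-map⁻ (c ∷_) b∷u∈
  ... | _ , u∈ , refl = refl , u∈
  disjoint : ∀ {v} → ¬ (v ∈ E₁ × v ∈ E₀)
  disjoint {_ ∷ _} (v∈₁ , v∈₀) with ∈-map-∷⁻ v∈₁ | ∈-map-∷⁻ v∈₀
  ... | refl , _ | () , _
  E⇒P : ∀ v → v ∈ E₁ List.++ E₀ → P v
  E⇒P (b ∷ u) v∈ with ∈-++⁻ E₁ v∈
  ... | inj₁ v∈₁ with ∈-map-∷⁻ v∈₁
  ...   | refl , u∈ = Equivalence.to (e₁ u) (Equivalence.to (complete h₁ u) u∈)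
  E⇒P (b ∷ u) v∈ | inj₂ v∈₀ with ∈-map-∷⁻ v∈₀
  ...   | refl , u∈ = Equivalence.to (e₀ u) (Equivalence.to (complete h₀ u) u∈)
  P⇒E : ∀ v → P v → v ∈ E₁ List.++ E₀
  P⇒E (true ∷ u)  p = ∈-++⁺ˡ (∈-map⁺ (true ∷_) (Equivalence.from (⇔.trans (complete h₁ u) (e₁ u)) p))
  P⇒E (false ∷ u) p = ∈-++⁺ʳ E₁ (∈-map⁺ (false ∷_) (Equivalence.from (⇔.trans (complete h₀ u) (e₀ u)) p))

count-Vec : ∀ k → HasCount {Vec Bool k} (λ _ → ⊤) (2 ^ k)
count-Vec zero    = record { elems = [] ∷ [] ; unique = All.[] AllPairs.∷ AllPairs.[]
                           ; complete = λ { [] → mk⇔ (λ _ → tt) (λ _ → here refl) } ; size = refl }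
count-Vec (suc k) = subst (HasCount _) (cong (2 ^ k +_) (sym (ℕ.+-identityʳ (2 ^ k))))
  (count-Vec-∷ (count-Vec k) (count-Vec k) (λ _ → mk⇔ _ _) (λ _ → mk⇔ _ _))

-- A path of p + 1 edges, each bit saying whether that edge points along
-- the path; it acts as a single directed arc only if all bits agree.
Path : ℕ → Set
Path p = Vec Bool (suc p)

arrowOf : Bool → Dir
arrowOf true  = forward
arrowOf false = backward

dir : ∀ {p} → Path p → Dir
dir (b ∷ [])     = arrowOf b
dir (b ∷ c ∷ bs) = arrowOf b ⨾ dir (c ∷ bs)

dir-++ : ∀ {p q} (u : Path p) (v : Path q) → dir (u ++ v) ≡ dir u ⨾ dir v
dir-++ (b ∷ [])     (c ∷ v) = refl
dir-++ (b ∷ b′ ∷ u) (c ∷ v) =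
  trans (cong (arrowOf b ⨾_) (dir-++ (b′ ∷ u) (c ∷ v)))
        (sym (⨾-assoc (arrowOf b) (dir (b′ ∷ u)) (dir (c ∷ v))))

forward⨾-blocked : ∀ d → (¬ d ≡ forward) ⇔ (forward ⨾ d ≡ blocked)
forward⨾-blocked forward  = mk⇔ (λ d≢ → ⊥-elim (d≢ refl)) (λ ())
forward⨾-blocked backward = mk⇔ (λ _ → refl) (λ _ ())
forward⨾-blocked blocked  = mk⇔ (λ _ → refl) (λ _ ())

backward⨾-blocked : ∀ d → (¬ d ≡ backward) ⇔ (backward ⨾ d ≡ blocked)
backward⨾-blocked forward  = mk⇔ (λ _ → refl) (λ _ ())
backward⨾-blocked backward = mk⇔ (λ d≢ → ⊥-elim (d≢ refl)) (λ ())
backward⨾-blocked blocked  = mk⇔ (λ _ → refl) (λ _ ())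

forward⨾-≢forward : ∀ d → (¬ d ≡ forward) ⇔ (¬ forward ⨾ d ≡ forward)
forward⨾-≢forward forward  = mk⇔ (λ d≢ _ → d≢ refl) (λ d≢ _ → d≢ refl)
forward⨾-≢forward backward = mk⇔ (λ _ ()) (λ _ ())
forward⨾-≢forward blocked  = mk⇔ (λ _ ()) (λ _ ())

backward⨾-≢backward : ∀ d → (¬ d ≡ backward) ⇔ (¬ backward ⨾ d ≡ backward)
backward⨾-≢backward forward  = mk⇔ (λ _ ()) (λ _ ())
backward⨾-≢backward backward = mk⇔ (λ d≢ _ → d≢ refl) (λ d≢ _ → d≢ refl)
backward⨾-≢backward blocked  = mk⇔ (λ _ ()) (λ _ ())

forward⨾-≢backward : ∀ d → ¬ forward ⨾ d ≡ backward
forward⨾-≢backward forward  ()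
forward⨾-≢backward backward ()
forward⨾-≢backward blocked  ()

backward⨾-≢forward : ∀ d → ¬ backward ⨾ d ≡ forward
backward⨾-≢forward forward  ()
backward⨾-≢forward backward ()
backward⨾-≢forward blocked  ()

nonForwardPaths : ℕ → ℕ
nonForwardPaths zero    = 1
nonForwardPaths (suc p) = nonForwardPaths p + 2 ^ suc p

blockedPaths : ℕ → ℕ
blockedPaths zero    = 0
blockedPaths (suc p) = nonForwardPaths p + nonForwardPaths p

count-nonForward : ∀ p → HasCount {Path p} (λ v → ¬ dir v ≡ forward) (nonForwardPaths p)
count-nonForward zero    = count-Vec-∷ count-∅ (count-Vec 0)
  (λ { [] → mk⇔ (λ ()) (λ f≢ → f≢ refl) }) (λ { [] → mk⇔ (λ _ ()) _ })
count-nonForward (suc p) = count-Vec-∷ (count-nonForward p) (count-Vec (suc p))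
  (λ { (c ∷ v) → forward⨾-≢forward (dir (c ∷ v)) })
  (λ { (c ∷ v) → mk⇔ (λ _ → backward⨾-≢forward _) _ })

count-nonBackward : ∀ p → HasCount {Path p} (λ v → ¬ dir v ≡ backward) (nonForwardPaths p)
count-nonBackward zero    = count-Vec-∷ (count-Vec 0) count-∅
  (λ { [] → mk⇔ (λ _ ()) _ }) (λ { [] → mk⇔ (λ ()) (λ b≢ → b≢ refl) })
count-nonBackward (suc p) = subst (HasCount _) (ℕ.+-comm (2 ^ suc p) (nonForwardPaths p))
  (count-Vec-∷ (count-Vec (suc p)) (count-nonBackward p)
    (λ { (c ∷ v) → mk⇔ (λ _ → forward⨾-≢backward _) _ })
    (λ { (c ∷ v) → backward⨾-≢backward (dir (c ∷ v)) }))

count-blocked : ∀ p → HasCount {Path p} (λ v → dir v ≡ blocked) (blockedPaths p)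
count-blocked zero    = count-Vec-∷ count-∅ count-∅
  (λ { [] → mk⇔ (λ ()) (λ ()) }) (λ { [] → mk⇔ (λ ()) (λ ()) })
count-blocked (suc p) = count-Vec-∷ (count-nonForward p) (count-nonBackward p)
  (λ { (c ∷ v) → forward⨾-blocked (dir (c ∷ v)) }) (λ { (c ∷ v) → backward⨾-blocked (dir (c ∷ v)) })

-- Tables indexed by binary words

data Table (A : Set) : ℕ → Set where
  leaf : A → Table A zero
  node : ∀ {m} → Table A m → Table A m → Table A (suc m)

infixl 9 _‼_

_‼_ : ∀ {A m} → Table A m → Word m → A
leaf a     ‼ []          = a
node t₀ _  ‼ (false ∷ w) = t₀ ‼ w
node _  t₁ ‼ (true ∷ w)  = t₁ ‼ w

leaf↔ : ∀ {A} → Table A zero ↔ A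
leaf↔ = mk↔ₛ′ (λ { (leaf a) → a }) leaf (λ _ → refl) (λ { (leaf a) → refl })

node↔ : ∀ {A m} → (Table A m × Table A m) ↔ Table A (suc m)
node↔ = mk↔ₛ′ (λ (t₀ , t₁) → node t₀ t₁) children (λ { (node _ _) → refl }) (λ _ → refl)
  where
  children : ∀ {A m} → Table A (suc m) → Table A m × Table A m
  children (node t₀ t₁) = t₀ , t₁

module _ {A B C : Set} (e : (A × B) ↔ C) where
  open Inverse e

  zipT : ∀ {m} → Table A m → Table B m → Table C m
  zipT (leaf a)     (leaf b)     = leaf (to (a , b))
  zipT (node s₀ s₁) (node t₀ t₁) = node (zipT s₀ t₀) (zipT s₁ t₁)

  unzipT : ∀ {m} → Table C m → Table A m × Table B m
  unzipT (leaf c)     = let a , b = from c in leaf a , leaf b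
  unzipT (node u₀ u₁) = let s₀ , t₀ = unzipT u₀ ; s₁ , t₁ = unzipT u₁ in node s₀ s₁ , node t₀ t₁

  zipT-unzipT : ∀ {m} (u : Table C m) → zipT (proj₁ (unzipT u)) (proj₂ (unzipT u)) ≡ u
  zipT-unzipT (leaf c)     = cong leaf (strictlyInverseˡ c)
  zipT-unzipT (node u₀ u₁) = cong₂ node (zipT-unzipT u₀) (zipT-unzipT u₁)

  unzipT-zipT : ∀ {m} (s : Table A m) (t : Table B m) → unzipT (zipT s t) ≡ (s , t)
  unzipT-zipT (leaf a) (leaf b) = cong (λ (a , b) → leaf a , leaf b) (strictlyInverseʳ (a , b))
  unzipT-zipT (node s₀ s₁) (node t₀ t₁)
    rewrite unzipT-zipT s₀ t₀ | unzipT-zipT s₁ t₁ = refl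

  zip↔ : ∀ {m} → (Table A m × Table B m) ↔ Table C m
  zip↔ = mk↔ₛ′ (λ (s , t) → zipT s t) unzipT zipT-unzipT (λ (s , t) → unzipT-zipT s t)

  ‼-zipT : ∀ {m} (s : Table A m) (t : Table B m) w → zipT s t ‼ w ≡ to (s ‼ w , t ‼ w)
  ‼-zipT (leaf a)     (leaf b)     []        = refl
  ‼-zipT (node s₀ _)  (node t₀ _)  (false ∷ w) = ‼-zipT s₀ t₀ w
  ‼-zipT (node _  s₁) (node _  t₁) (true ∷ w)  = ‼-zipT s₁ t₁ w

permuteA permuteB unpermuteA unpermuteB : ∀ {A m} → Table A m → Table A m
permuteA (leaf a)     = leaf a
permuteA (node t₀ t₁) = node (permuteB t₀) t₁
permuteB (leaf a)     = leaf a
permuteB (node t₀ t₁) = node (permuteA t₁) t₀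
unpermuteA (leaf a)     = leaf a
unpermuteA (node t₀ t₁) = node (unpermuteB t₀) t₁
unpermuteB (leaf a)     = leaf a
unpermuteB (node t₀ t₁) = node t₁ (unpermuteA t₀)

‼-permuteA : ∀ {A m} (t : Table A m) w → permuteA t ‼ w ≡ t ‼ basA w
‼-permuteB : ∀ {A m} (t : Table A m) w → permuteB t ‼ w ≡ t ‼ basB w
‼-permuteA (leaf a)    []          = refl
‼-permuteA (node t₀ _) (false ∷ w) = ‼-permuteB t₀ w
‼-permuteA (node _ _)  (true ∷ w)  = refl
‼-permuteB (leaf a)    []          = refl
‼-permuteB (node _ t₁) (false ∷ w) = ‼-permuteA t₁ w
‼-permuteB (node _ _)  (true ∷ w)  = refl

permuteA-unpermuteA : ∀ {A m} (t : Table A m) → permuteA (unpermuteA t) ≡ t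
permuteB-unpermuteB : ∀ {A m} (t : Table A m) → permuteB (unpermuteB t) ≡ t
permuteA-unpermuteA (leaf a)     = refl
permuteA-unpermuteA (node t₀ t₁) = cong (λ t → node t t₁) (permuteB-unpermuteB t₀)
permuteB-unpermuteB (leaf a)     = refl
permuteB-unpermuteB (node t₀ t₁) = cong (λ t → node t t₁) (permuteA-unpermuteA t₀)

unpermuteA-permuteA : ∀ {A m} (t : Table A m) → unpermuteA (permuteA t) ≡ t
unpermuteB-permuteB : ∀ {A m} (t : Table A m) → unpermuteB (permuteB t) ≡ t
unpermuteA-permuteA (leaf a)     = refl
unpermuteA-permuteA (node t₀ t₁) = cong (λ t → node t t₁) (unpermuteB-permuteB t₀)
unpermuteB-permuteB (leaf a)     = refl
unpermuteB-permuteB (node t₀ t₁) = cong (node t₀) (unpermuteA-permuteA t₁)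

permuteA↔ : ∀ {A m} → Table A m ↔ Table A m
permuteA↔ = mk↔ₛ′ permuteA unpermuteA permuteA-unpermuteA unpermuteA-permuteA

AllT : ∀ {A m} → (A → Set) → Table A m → Set
AllT P (leaf a)     = P a
AllT P (node t₀ t₁) = AllT P t₀ × AllT P t₁

AllT⇔‼ : ∀ {A m} (P : A → Set) (t : Table A m) → AllT P t ⇔ (∀ w → P (t ‼ w))
AllT⇔‼ P (leaf a)     = mk⇔ (λ { p [] → p }) (λ f → f [])
AllT⇔‼ P (node t₀ t₁) = mk⇔
  (λ { (p₀ , _) (false ∷ w) → Equivalence.to (AllT⇔‼ P t₀) p₀ w
      ; (_ , p₁) (true ∷ w)  → Equivalence.to (AllT⇔‼ P t₁) p₁ w })
  (λ f → Equivalence.from (AllT⇔‼ P t₀) (f ∘ (false ∷_)) , Equivalence.from (AllT⇔‼ P t₁) (f ∘ (true ∷_)))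

count-AllT : ∀ m {A : Set} {P : A → Set} {N} → HasCount P N → HasCount (AllT {m = m} P) (N ^ 2 ^ m)
count-AllT zero    {N = N} h =
  subst (HasCount _) (sym (ℕ.*-identityʳ N)) (count-image (↔-sym leaf↔) (λ _ → ⇔.refl) h)
count-AllT (suc m) {N = N} h = subst (HasCount _) N^2^m*N^2^m≡N^2^[1+m]
  (count-image node↔ (λ _ → ⇔.refl) (count-× (count-AllT m h) (count-AllT m h)))
  where
  N^2^m*N^2^m≡N^2^[1+m] : N ^ 2 ^ m * N ^ 2 ^ m ≡ N ^ 2 ^ suc m
  N^2^m*N^2^m≡N^2^[1+m] = trans (sym (ℕ.^-distribˡ-+-* N (2 ^ m) (2 ^ m)))
    (cong (λ k → N ^ (2 ^ m + k)) (sym (ℕ.+-identityʳ (2 ^ m))))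

++↔ : ∀ {A : Set} a {b} → (Vec A a × Vec A b) ↔ Vec A (a + b)
++↔ a = mk↔ₛ′ (λ (u , v) → u ++ v) (λ w → take a w , drop a w) (take++drop≡id a)
  (λ (u , v) → let take≡ , drop≡ = ++-injective (take a (u ++ v)) u (take++drop≡id a (u ++ v))
               in cong₂ _,_ take≡ drop≡)

-- The graph on Word m in which every a-edge is subdivided into p + 1 edges
-- and every b-edge into q + 1 edges; an element orients all of these edges.
Assignment : ℕ → ℕ → ℕ → Set
Assignment m p q = Table (Path p) m × Table (Path q) m

dirs : ∀ {m p q} → Assignment m p q → Directions m
dirs (A , B) w gA = dir (A ‼ w)
dirs (A , B) w gB = dir (B ‼ w)

-- the b-paths 0w → 1a(w) and 1a(w) → 0a(w) glued into one a-path at w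
merge↔ : ∀ {m q} → Table (Path q) (suc m) ↔ Table (Path (q + suc q)) m
merge↔ {q = q} = ↔-trans (↔-sym node↔) (↔-trans (↔-refl ×-↔ permuteA↔) (zip↔ (++↔ (suc q))))

contract-merge : ∀ {m p q} (R : Directions (suc m)) (A₀ : Table (Path p) m) (B : Table (Path q) (suc m)) →
  (∀ w → R (false ∷ w) gA ≡ dir (A₀ ‼ w)) → (∀ u → R u gB ≡ dir (B ‼ u)) →
  ∀ w s → contract R w s ≡ dirs (Inverse.to merge↔ B , A₀) w s
contract-merge {q = q} R A₀ (node B₀ B₁) RA RB w gA = begin
  R (false ∷ w) gB ⨾ R (true ∷ basA w) gB        ≡⟨ cong₂ _⨾_ (RB (false ∷ w)) (RB (true ∷ basA w)) ⟩
  dir (B₀ ‼ w) ⨾ dir (B₁ ‼ basA w)              ≡⟨ cong (λ v → dir (B₀ ‼ w) ⨾ dir v) (sym (‼-permuteA B₁ w)) ⟩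
  dir (B₀ ‼ w) ⨾ dir (permuteA B₁ ‼ w)          ≡⟨ sym (dir-++ (B₀ ‼ w) (permuteA B₁ ‼ w)) ⟩
  dir (B₀ ‼ w ++ permuteA B₁ ‼ w)               ≡⟨ cong dir (sym (‼-zipT (++↔ (suc q)) B₀ (permuteA B₁) w)) ⟩
  dir (zipT (++↔ (suc q)) B₀ (permuteA B₁) ‼ w) ∎
  where open ≡-Reasoning
contract-merge R A₀ (node _ _) RA RB w gB = RA w

step↔ : ∀ {m p q} → Assignment (suc m) p q ↔ (Table (Path p) m × Assignment m (q + suc q) p)
step↔ {m} {p} {q} = mk↔ₛ′ split join (λ (_ , C , _) → cong (λ C → _ , C , _) (strictlyInverseˡ C))
  (λ { (node _ _ , B) → cong (_ ,_) (strictlyInverseʳ B) })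
  where
  open Inverse (merge↔ {m} {q})
  split : Assignment (suc m) p q → Table (Path p) m × Assignment m (q + suc q) p
  split (node A₀ A₁ , B) = A₁ , to B , A₀
  join : Table (Path p) m × Assignment m (q + suc q) p → Assignment (suc m) p q
  join (A₁ , C , A₀) = node A₀ A₁ , from C

acyclicCount : ℕ → ℕ → ℕ → ℕ
acyclicCount zero    p q = blockedPaths p * blockedPaths q
acyclicCount (suc m) p q = blockedPaths p ^ 2 ^ m * acyclicCount m (q + suc q) p

count-loopsBlocked : ∀ m p q → HasCount (λ (X : Assignment m p q) → LoopsBlocked m (dirs X)) (acyclicCount m p q)
count-loopsBlocked zero    p q = count-preimage (leaf↔ ×-↔ leaf↔) (λ { (leaf _ , leaf _) → ⇔.refl })
  (count-× (count-blocked p) (count-blocked q))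
count-loopsBlocked (suc m) p q = count-preimage step↔ (λ { X@(node A₀ A₁ , B) →
    ⇔.sym (AllT⇔‼ _ A₁) ×-⇔ loopsBlocked-≗ m (contract-merge (dirs X) A₀ B (λ _ → refl) (λ _ → refl)) })
  (count-× (count-AllT m (count-blocked p)) (count-loopsBlocked m (q + suc q) p))

-- Orientations of edge lists

module _ {n : ℕ} where

  arcs : (L : List (Word n × Word n)) → Vec Bool (length L) → List (Word n × Word n)
  arcs []      []      = []
  arcs (e ∷ L) (b ∷ o) = orient e b ∷ arcs L o

  lookup⇔∈arcs : ∀ L o {x y} →
    (∃ λ i → orient (lookup (fromList L) i) (lookup o i) ≡ (x , y)) ⇔ ((x , y) ∈ arcs L o)
  lookup⇔∈arcs L o = mk⇔ (lookup⇒∈ L o) (∈⇒lookup L o)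
    where
    lookup⇒∈ : ∀ L o {x y} → (∃ λ i → orient (lookup (fromList L) i) (lookup o i) ≡ (x , y)) →
      (x , y) ∈ arcs L o
    lookup⇒∈ (_ ∷ L) (_ ∷ o) (zero  , p) = here (sym p)
    lookup⇒∈ (_ ∷ L) (_ ∷ o) (suc i , p) = there (lookup⇒∈ L o (i , p))
    ∈⇒lookup : ∀ L o {x y} → (x , y) ∈ arcs L o →
      ∃ λ i → orient (lookup (fromList L) i) (lookup o i) ≡ (x , y)
    ∈⇒lookup []      []      ()
    ∈⇒lookup (_ ∷ L) (_ ∷ o) (here p)   = zero , sym p
    ∈⇒lookup (_ ∷ L) (_ ∷ o) (there xy∈) = let i , p = ∈⇒lookup L o xy∈ in suc i , p

  AcyclicArcs : (L : List (Word n × Word n)) → Vec Bool (length L) → Set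
  AcyclicArcs L o = ¬ (∃ λ x → TransClosure (λ x y → (x , y) ∈ arcs L o) x x)

  ++-bits↔ : ∀ (L₁ L₂ : List (Word n × Word n)) →
    (Vec Bool (length L₁) × Vec Bool (length L₂)) ↔ Vec Bool (length (L₁ List.++ L₂))
  ++-bits↔ []       L₂ = mk↔ₛ′ proj₂ ([] ,_) (λ _ → refl) (λ { ([] , _) → refl })
  ++-bits↔ (e ∷ L₁) L₂ = mk↔ₛ′ (λ { (b ∷ o₁ , o₂) → b ∷ to (o₁ , o₂) })
    (λ { (b ∷ o) → let o₁ , o₂ = from o in b ∷ o₁ , o₂ })
    (λ { (b ∷ o) → cong (b ∷_) (strictlyInverseˡ o) })
    (λ { (b ∷ o₁ , o₂) → cong (λ (o₁ , o₂) → b ∷ o₁ , o₂) (strictlyInverseʳ (o₁ , o₂)) })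
    where open Inverse (++-bits↔ L₁ L₂)

  arcs-++ : ∀ L₁ L₂ o₁ o₂ →
    arcs (L₁ List.++ L₂) (Inverse.to (++-bits↔ L₁ L₂) (o₁ , o₂)) ≡ arcs L₁ o₁ List.++ arcs L₂ o₂
  arcs-++ []       L₂ []       o₂ = refl
  arcs-++ (e ∷ L₁) L₂ (b ∷ o₁) o₂ = cong (orient e b ∷_) (arcs-++ L₁ L₂ o₁ o₂)

  ∈-arcs-++ : ∀ L₁ L₂ o₁ o₂ {xy} →
    (xy ∈ arcs (L₁ List.++ L₂) (Inverse.to (++-bits↔ L₁ L₂) (o₁ , o₂))) ⇔ (xy ∈ arcs L₁ o₁ ⊎ xy ∈ arcs L₂ o₂)
  ∈-arcs-++ L₁ L₂ o₁ o₂ {xy} =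
    ⇔.trans (≡⇒ {k = equivalence} (cong (xy ∈_) (arcs-++ L₁ L₂ o₁ o₂))) (↔⇒⇔ (↔-sym Any.++↔))

  flatten : ∀ m → (Word m → List (Word n × Word n)) → List (Word n × Word n)
  flatten zero    f = f []
  flatten (suc m) f = flatten m (f ∘ (false ∷_)) List.++ flatten m (f ∘ (true ∷_))

  concatMap-allWords : ∀ m (f : Word m → List (Word n × Word n)) → List.concatMap f (allWords m) ≡ flatten m f
  concatMap-allWords zero    f = List.++-identityʳ (f [])
  concatMap-allWords (suc m) f = begin
    List.concatMap f (List.map (false ∷_) (allWords m) List.++ List.map (true ∷_) (allWords m))
      ≡⟨ List.concatMap-++ f (List.map (false ∷_) (allWords m)) _ ⟩
    List.concatMap f (List.map (false ∷_) (allWords m)) List.++ List.concatMap f (List.map (true ∷_) (allWords m))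
      ≡⟨ cong₂ List._++_ (List.concatMap-map f (false ∷_) (allWords m))
                         (List.concatMap-map f (true ∷_) (allWords m)) ⟩
    List.concatMap (f ∘ (false ∷_)) (allWords m) List.++ List.concatMap (f ∘ (true ∷_)) (allWords m)
      ≡⟨ cong₂ List._++_ (concatMap-allWords m (f ∘ (false ∷_))) (concatMap-allWords m (f ∘ (true ∷_))) ⟩
    flatten (suc m) f ∎
    where open ≡-Reasoning

  flatten↔ : ∀ m (f : Word m → List (Word n × Word n)) {Leaf : Set} →
    (∀ w → Leaf ↔ Vec Bool (length (f w))) → Table Leaf m ↔ Vec Bool (length (flatten m f))
  flatten↔ zero    f e = ↔-trans leaf↔ (e [])
  flatten↔ (suc m) f e = ↔-trans (↔-sym node↔)
    (↔-trans (flatten↔ m (f ∘ (false ∷_)) (e ∘ (false ∷_)) ×-↔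
              flatten↔ m (f ∘ (true ∷_)) (e ∘ (true ∷_)))
             (++-bits↔ (flatten m (f ∘ (false ∷_))) (flatten m (f ∘ (true ∷_)))))

  ∈-arcs-flatten : ∀ m (f : Word m → List (Word n × Word n)) {Leaf : Set}
    (e : ∀ w → Leaf ↔ Vec Bool (length (f w))) (t : Table Leaf m) {xy} →
    (xy ∈ arcs (flatten m f) (Inverse.to (flatten↔ m f e) t)) ⇔ (∃ λ w → xy ∈ arcs (f w) (Inverse.to (e w) (t ‼ w)))
  ∈-arcs-flatten zero    f e (leaf a) = mk⇔ ([] ,_) (λ { ([] , xy∈) → xy∈ })
  ∈-arcs-flatten (suc m) f e (node t₀ t₁) =
    ⇔.trans (∈-arcs-++ (flatten m (f ∘ (false ∷_))) (flatten m (f ∘ (true ∷_))) _ _)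
    (⇔.trans (∈-arcs-flatten m (f ∘ (false ∷_)) (e ∘ (false ∷_)) t₀ ⊎-⇔
              ∈-arcs-flatten m (f ∘ (true ∷_)) (e ∘ (true ∷_)) t₁)
             ∃-Word-suc⇔)
    where
    ∃-Word-suc⇔ : ∀ {P : Word (suc m) → Set} → ((∃ λ w → P (false ∷ w)) ⊎ (∃ λ w → P (true ∷ w))) ⇔ ∃ P
    ∃-Word-suc⇔ = mk⇔ [ (λ (w , p) → false ∷ w , p) , (λ (w , p) → true ∷ w , p) ]′
      (λ { (false ∷ w , p) → inj₁ (w , p) ; (true ∷ w , p) → inj₂ (w , p) })

acyclic-resp : ∀ {V : Set} {R S : V → V → Set} → (∀ {x y} → R x y ⇔ S x y) →
  (¬ ∃ λ x → TransClosure R x x) ⇔ (¬ ∃ λ x → TransClosure S x x)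
acyclic-resp {V} R⇔S = mk⇔ (λ noR (x , c) → noR (x , map⁺ (Equivalence.from R⇔S) c))
                       (λ noS (x , c) → noS (x , map⁺ (Equivalence.to R⇔S) c))
  where
  map⁺ : ∀ {R S : V → V → Set} → (∀ {x y} → R x y → S x y) → ∀ {x y} → TransClosure R x y → TransClosure S x y
  map⁺ f = Equivalence.to TC.equivalent ∘ TC.map f ∘ Equivalence.from TC.equivalent

ArrowAlong : ∀ {n} → Dir → Word n × Word n → Word n → Word n → Set
ArrowAlong d (u , v) x y = (d ≡ forward × (x , y) ≡ (u , v)) ⊎ (d ≡ backward × (x , y) ≡ (v , u))

∈-arcs-single : ∀ {n} (b : Path 0) (e : Word n × Word n) {x y} →
  ((x , y) ∈ arcs (e ∷ []) b) ⇔ ArrowAlong (dir b) e x y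
∈-arcs-single (true ∷ [])  e = mk⇔ (λ { (here refl) → inj₁ (refl , refl) })
                                   (λ { (inj₁ (_ , refl)) → here refl ; (inj₂ (() , _)) })
∈-arcs-single (false ∷ []) e = mk⇔ (λ { (here refl) → inj₂ (refl , refl) })
                                   (λ { (inj₁ (() , _)) ; (inj₂ (_ , refl)) → here refl })

schreierEdge-loop : ∀ {m} (u : Word m) s → act s u ≡ u → schreierEdge u s ≡ []
schreierEdge-loop u s loop rewrite dec-true (≡-dec Bool._≟_ (act s u) u) loop = refl

schreierEdge-nonloop : ∀ {m} (u : Word m) s → ¬ act s u ≡ u → schreierEdge u s ≡ (u , act s u) ∷ []
schreierEdge-nonloop u s nonloop rewrite dec-false (≡-dec Bool._≟_ (act s u) u) nonloop = refl

basB-fixpointFree : ∀ {m} (w : Word (suc m)) → ¬ basB w ≡ w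
basB-fixpointFree (false ∷ _) ()
basB-fixpointFree (true ∷ _)  ()

-- Vertices 1w carry no a-edge (it is a deleted loop); an orientation is
-- described by the b-edges B at all vertices and the a-edges A₀ at 0-words.
module BStar (k : ℕ) where

  aEdge bEdge₀ bEdge₁ : Word (suc k) → Word (suc (suc k)) × Word (suc (suc k))
  aEdge  w = false ∷ w , act gA (false ∷ w)
  bEdge₀ w = false ∷ w , act gB (false ∷ w)
  bEdge₁ w = true ∷ w , act gB (true ∷ w)

  edgesAt : Word (suc (suc k)) → List (Word (suc (suc k)) × Word (suc (suc k)))
  edgesAt (false ∷ w) = aEdge w ∷ bEdge₀ w ∷ []
  edgesAt (true ∷ w)  = bEdge₁ w ∷ []

  edgesB*≡flatten : edgesB* (suc (suc k)) ≡ flatten (suc (suc k)) edgesAt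
  edgesB*≡flatten = trans (List.concatMap-cong schreierEdges≡edgesAt (allWords _)) (concatMap-allWords _ edgesAt)
    where
    schreierEdges≡edgesAt : ∀ u → schreierEdge u gA List.++ schreierEdge u gB ≡ edgesAt u
    schreierEdges≡edgesAt (false ∷ w)
      rewrite schreierEdge-nonloop (false ∷ w) gA (basB-fixpointFree w ∘ ∷-injectiveʳ)
            | schreierEdge-nonloop (false ∷ w) gB (λ ()) = refl
    schreierEdges≡edgesAt (true ∷ w)
      rewrite schreierEdge-loop (true ∷ w) gA refl
            | schreierEdge-nonloop (true ∷ w) gB (λ ()) = refl

  Bits : Set
  Bits = Table (Path 0) (suc (suc k)) × Table (Path 0) (suc k)

  directionsOf : Bits → Directions (suc (suc k))
  directionsOf (B , A₀) u           gB = dir (B ‼ u)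
  directionsOf (B , A₀) (false ∷ w) gA = dir (A₀ ‼ w)
  directionsOf (B , A₀) (true ∷ w)  gA = blocked

  L₀ L₁ : List (Word (suc (suc k)) × Word (suc (suc k)))
  L₀ = flatten (suc k) (edgesAt ∘ (false ∷_))
  L₁ = flatten (suc k) (edgesAt ∘ (true ∷_))

  pair↔ : ∀ w → (Path 0 × Path 0) ↔ Vec Bool (length (edgesAt (false ∷ w)))
  pair↔ w = ++-bits↔ (aEdge w ∷ []) (bEdge₀ w ∷ [])

  orientation₀↔ : Table (Path 0 × Path 0) (suc k) ↔ Vec Bool (length L₀)
  orientation₀↔ = flatten↔ (suc k) (edgesAt ∘ (false ∷_)) pair↔

  orientation₁↔ : Table (Path 0) (suc k) ↔ Vec Bool (length L₁)
  orientation₁↔ = flatten↔ (suc k) (edgesAt ∘ (true ∷_)) λ _ → ↔-refl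

  orientation↔ : Bits ↔ Vec Bool (length (flatten (suc (suc k)) edgesAt))
  orientation↔ = ↔-trans (↔-sym node↔ ×-↔ ↔-refl) (↔-trans regroup (↔-trans (zip↔ ↔-refl ×-↔ ↔-refl)
    (↔-trans (orientation₀↔ ×-↔ orientation₁↔) (++-bits↔ L₀ L₁))))
    where
    regroup : ∀ {A B C : Set} → ((A × B) × C) ↔ ((C × A) × B)
    regroup = mk↔ₛ′ (λ ((a , b) , c) → (c , a) , b) (λ ((c , a) , b) → (a , b) , c)
                    (λ _ → refl) (λ _ → refl)

  ∈-arcs⇔Arrow : ∀ t {x y} →
    ((x , y) ∈ arcs (flatten (suc (suc k)) edgesAt) (Inverse.to orientation↔ t)) ⇔ Arrow (directionsOf t) x y
  ∈-arcs⇔Arrow (node B₀ B₁ , A₀) =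
    ⇔.trans (∈-arcs-++ L₀ L₁ _ _) (⇔.trans (∈-arcs₀ ⊎-⇔ ∈-arcs₁) (mk⇔ toArrow fromArrow))
    where
    R : Directions (suc (suc k))
    R = directionsOf (node B₀ B₁ , A₀)
    At0 At1 : Word (suc (suc k)) → Word (suc (suc k)) → Word (suc k) → Set
    At0 x y w = ArrowAlong (dir (A₀ ‼ w)) (aEdge w) x y ⊎ ArrowAlong (dir (B₀ ‼ w)) (bEdge₀ w) x y
    At1 x y w = ArrowAlong (dir (B₁ ‼ w)) (bEdge₁ w) x y

    ∈-arcs₀ : ∀ {x y} → ((x , y) ∈ arcs L₀ (Inverse.to orientation₀↔ (zipT ↔-refl A₀ B₀))) ⇔ ∃ (At0 x y)
    ∈-arcs₀ {x} {y} = ⇔.trans (∈-arcs-flatten (suc k) (edgesAt ∘ (false ∷_)) pair↔ (zipT ↔-refl A₀ B₀))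
      (Σ.congˡ {k = equivalence} λ {w} →
        ⇔.trans (≡⇒ {k = equivalence} (cong (λ o → (x , y) ∈ arcs (edgesAt (false ∷ w)) (Inverse.to (pair↔ w) o))
                           (‼-zipT ↔-refl A₀ B₀ w)))
          (⇔.trans (∈-arcs-++ (aEdge w ∷ []) (bEdge₀ w ∷ []) (A₀ ‼ w) (B₀ ‼ w))
                   (∈-arcs-single (A₀ ‼ w) (aEdge w) ⊎-⇔ ∈-arcs-single (B₀ ‼ w) (bEdge₀ w))))

    ∈-arcs₁ : ∀ {x y} → ((x , y) ∈ arcs L₁ (Inverse.to orientation₁↔ B₁)) ⇔ ∃ (At1 x y)
    ∈-arcs₁ = ⇔.trans (∈-arcs-flatten (suc k) (edgesAt ∘ (true ∷_)) (λ _ → ↔-refl) B₁)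
      (Σ.congˡ {k = equivalence} λ {w} → ∈-arcs-single (B₁ ‼ w) (bEdge₁ w))

    toArrow : ∀ {x y} → ∃ (At0 x y) ⊎ ∃ (At1 x y) → Arrow R x y
    toArrow (inj₁ (_ , inj₁ (inj₁ (r , refl)))) = gA , inj₁ (r , refl)
    toArrow (inj₁ (_ , inj₁ (inj₂ (r , refl)))) = gA , inj₂ (r , refl)
    toArrow (inj₁ (_ , inj₂ (inj₁ (r , refl)))) = gB , inj₁ (r , refl)
    toArrow (inj₁ (_ , inj₂ (inj₂ (r , refl)))) = gB , inj₂ (r , refl)
    toArrow (inj₂ (_ , inj₁ (r , refl)))        = gB , inj₁ (r , refl)
    toArrow (inj₂ (_ , inj₂ (r , refl)))        = gB , inj₂ (r , refl)

    fromArrow : ∀ {x y} → Arrow R x y → ∃ (At0 x y) ⊎ ∃ (At1 x y)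
    fromArrow {false ∷ w}     (gA , inj₁ (r , refl)) = inj₁ (w , inj₁ (inj₁ (r , refl)))
    fromArrow {false ∷ w}     (gB , inj₁ (r , refl)) = inj₁ (w , inj₂ (inj₁ (r , refl)))
    fromArrow {true ∷ w}      (gB , inj₁ (r , refl)) = inj₂ (w , inj₁ (r , refl))
    fromArrow {true ∷ _}      (gA , inj₁ (() , _))
    fromArrow {y = false ∷ w} (gA , inj₂ (r , refl)) = inj₁ (w , inj₁ (inj₂ (r , refl)))
    fromArrow {y = false ∷ w} (gB , inj₂ (r , refl)) = inj₁ (w , inj₂ (inj₂ (r , refl)))
    fromArrow {y = true ∷ w}  (gB , inj₂ (r , refl)) = inj₂ (w , inj₂ (r , refl))
    fromArrow {y = true ∷ _}  (gA , inj₂ (() , _))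

  loopsBlocked-directionsOf : ∀ B A₀ →
    LoopsBlocked (suc (suc k)) (directionsOf (B , A₀)) ⇔ LoopsBlocked (suc k) (dirs (Inverse.to merge↔ B , A₀))
  loopsBlocked-directionsOf B A₀ = mk⇔ (λ (_ , rest) → Equivalence.to contracted rest)
                                       (λ rest → (λ _ → refl) , Equivalence.from contracted rest)
    where
    contracted : LoopsBlocked (suc k) (contract (directionsOf (B , A₀))) ⇔ LoopsBlocked (suc k) (dirs (Inverse.to merge↔ B , A₀))
    contracted = loopsBlocked-≗ (suc k) (contract-merge (directionsOf (B , A₀)) A₀ B (λ _ → refl) (λ _ → refl))

  count-acyclic : HasCount (AcyclicArcs (flatten (suc (suc k)) edgesAt)) (acyclicCount (suc k) 1 0)
  count-acyclic = count-image orientation↔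
    (λ t → ⇔.trans (loopsBlocked⇔acyclic _ (directionsOf t)) (acyclic-resp (⇔.sym (∈-arcs⇔Arrow t))))
    (count-preimage (merge↔ ×-↔ ↔-refl) (λ (B , A₀) → loopsBlocked-directionsOf B A₀)
                    (count-loopsBlocked (suc k) 1 0))

numAcyclic-≥2 : ∀ k → NumAcyclicOrientations (suc (suc k)) (acyclicCount (suc k) 1 0)
numAcyclic-≥2 k = count-image ↔-refl (λ o → acyclic-resp (⇔.sym (lookup⇔∈arcs (edgesB* (suc (suc k))) o)))
  (subst (λ L → HasCount (AcyclicArcs L) (acyclicCount (suc k) 1 0)) (sym edgesB*≡flatten) count-acyclic)
  where open BStar k

-- Closed forms

mersenne : ℕ → ℕ
mersenne i = 2 ^ i ∸ 1

suc-mersenne : ∀ i → suc (mersenne i) ≡ 2 ^ i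
suc-mersenne i = ℕ.suc-pred (2 ^ i) {{ℕ.m^n≢0 2 i}}

mersenne-suc : ∀ i → mersenne (suc i) ≡ mersenne i + suc (mersenne i)
mersenne-suc i = ℕ.suc-injective (begin
  suc (mersenne (suc i))              ≡⟨ suc-mersenne (suc i) ⟩
  2 ^ i + (2 ^ i + 0)                 ≡⟨ cong (2 ^ i +_) (ℕ.+-identityʳ (2 ^ i)) ⟩
  2 ^ i + 2 ^ i                       ≡⟨ sym (cong₂ _+_ (suc-mersenne i) (suc-mersenne i)) ⟩
  suc (mersenne i) + suc (mersenne i) ∎)
  where open ≡-Reasoning

nonForwardPaths+1 : ∀ p → nonForwardPaths p + 1 ≡ 2 ^ suc p
nonForwardPaths+1 zero    = refl
nonForwardPaths+1 (suc p) = begin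
  nonForwardPaths p + 2 ^ suc p + 1   ≡⟨ x+y+1≡x+1+y (nonForwardPaths p) (2 ^ suc p) ⟩
  nonForwardPaths p + 1 + 2 ^ suc p   ≡⟨ cong (_+ 2 ^ suc p) (nonForwardPaths+1 p) ⟩
  2 ^ suc p + 2 ^ suc p               ≡⟨ cong (2 ^ suc p +_) (sym (ℕ.+-identityʳ (2 ^ suc p))) ⟩
  2 ^ suc (suc p)                     ∎
  where
  open ≡-Reasoning
  x+y+1≡x+1+y : ∀ x y → x + y + 1 ≡ x + 1 + y
  x+y+1≡x+1+y = solve-∀

blockedPaths≡ : ∀ p → blockedPaths p ≡ 2 ^ suc p ∸ 2
blockedPaths≡ p = trans (sym (ℕ.m+n∸n≡m (blockedPaths p) 2)) (cong (_∸ 2) (blockedPaths+2 p))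
  where
  blockedPaths+2 : ∀ p → blockedPaths p + 2 ≡ 2 ^ suc p
  blockedPaths+2 zero    = refl
  blockedPaths+2 (suc p) = begin
    nonForwardPaths p + nonForwardPaths p + 2         ≡⟨ x+x+2≡[x+1]+[x+1] (nonForwardPaths p) ⟩
    (nonForwardPaths p + 1) + (nonForwardPaths p + 1) ≡⟨ cong₂ _+_ (nonForwardPaths+1 p) (nonForwardPaths+1 p) ⟩
    2 ^ suc p + 2 ^ suc p                             ≡⟨ cong (2 ^ suc p +_) (sym (ℕ.+-identityʳ (2 ^ suc p))) ⟩
    2 ^ suc (suc p)                                   ∎
    where
    open ≡-Reasoning
    x+x+2≡[x+1]+[x+1] : ∀ x → x + x + 2 ≡ (x + 1) + (x + 1)
    x+x+2≡[x+1]+[x+1] = solve-∀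

blockedPaths-mersenne : ∀ i → blockedPaths (mersenne i) ≡ T i
blockedPaths-mersenne i = trans (blockedPaths≡ (mersenne i)) (cong (λ e → 2 ^ e ∸ 2) (suc-mersenne i))

-- Starting from paths of lengths 2^(i+1) and 2^i, two levels contribute
-- 2^(M+1) + 2^M = 3·2^M blocked a-paths of length 2^(i+1).
acyclicCount-step : ∀ M i → acyclicCount (2 + M) (mersenne (1 + i)) (mersenne i)
                          ≡ T (1 + i) ^ (3 * 2 ^ M) * acyclicCount M (mersenne (2 + i)) (mersenne (1 + i))
acyclicCount-step M i = begin
  b p ^ 2 ^ (1 + M) * (b (q + suc q) ^ 2 ^ M * acyclicCount M (p + suc p) (q + suc q))
    ≡⟨ cong₂ (λ q′ p′ → b p ^ 2 ^ (1 + M) * (b q′ ^ 2 ^ M * acyclicCount M p′ q′))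
             (sym (mersenne-suc i)) (sym (mersenne-suc (1 + i))) ⟩
  b p ^ 2 ^ (1 + M) * (b p ^ 2 ^ M * rest)
    ≡⟨ sym (ℕ.*-assoc (b p ^ 2 ^ (1 + M)) (b p ^ 2 ^ M) rest) ⟩
  b p ^ 2 ^ (1 + M) * b p ^ 2 ^ M * rest
    ≡⟨ cong (_* rest) (sym (ℕ.^-distribˡ-+-* (b p) (2 ^ (1 + M)) (2 ^ M))) ⟩
  b p ^ (2 ^ (1 + M) + 2 ^ M) * rest
    ≡⟨ cong₂ (λ x e → x ^ e * rest) (blockedPaths-mersenne (1 + i)) (2x+x≡3x (2 ^ M)) ⟩
  T (1 + i) ^ (3 * 2 ^ M) * rest ∎
  where
  open ≡-Reasoning
  b : ℕ → ℕ
  b = blockedPaths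
  p q rest : ℕ
  p = mersenne (1 + i)
  q = mersenne i
  rest = acyclicCount M (mersenne (2 + i)) p
  2x+x≡3x : ∀ x → 2 * x + x ≡ 3 * x
  2x+x≡3x = solve-∀

prod1-cong : ∀ r {F G : ℕ → ℕ} → (∀ i → F i ≡ G i) → prod1 r F ≡ prod1 r G
prod1-cong zero    F≗G = refl
prod1-cong (suc r) F≗G = cong₂ _*_ (prod1-cong r F≗G) (F≗G (suc r))

acyclicCount-unfold : ∀ j M → acyclicCount (2 * j + M) 1 0
  ≡ prod1 j (λ i → T i ^ (3 * 2 ^ (2 * j + M ∸ 2 * i))) * acyclicCount M (mersenne (suc j)) (mersenne j)
acyclicCount-unfold zero    M = sym (ℕ.+-identityʳ (acyclicCount M 1 0))
acyclicCount-unfold (suc j) M = begin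
  acyclicCount (2 * suc j + M) 1 0
    ≡⟨ cong (λ m → acyclicCount m 1 0) (shift j M) ⟩
  acyclicCount (2 * j + (2 + M)) 1 0
    ≡⟨ acyclicCount-unfold j (2 + M) ⟩
  prod1 j (F (2 * j + (2 + M))) * acyclicCount (2 + M) (mersenne (suc j)) (mersenne j)
    ≡⟨ cong₂ _*_ (cong (prod1 j ∘ F) (sym (shift j M))) (acyclicCount-step M j) ⟩
  prod1 j (F (2 * suc j + M)) * (T (suc j) ^ (3 * 2 ^ M) * rest)
    ≡⟨ sym (ℕ.*-assoc (prod1 j (F (2 * suc j + M))) _ rest) ⟩
  prod1 j (F (2 * suc j + M)) * T (suc j) ^ (3 * 2 ^ M) * rest
    ≡⟨ cong (λ e → prod1 j (F (2 * suc j + M)) * T (suc j) ^ (3 * 2 ^ e) * rest)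
            (sym (ℕ.m+n∸m≡n (2 * suc j) M)) ⟩
  prod1 (suc j) (F (2 * suc j + M)) * rest ∎
  where
  open ≡-Reasoning
  F : ℕ → ℕ → ℕ
  F N i = T i ^ (3 * 2 ^ (N ∸ 2 * i))
  rest : ℕ
  rest = acyclicCount M (mersenne (2 + j)) (mersenne (1 + j))
  shift : ∀ j M → 2 * suc j + M ≡ 2 * j + (2 + M)
  shift = solve-∀

a+1∸b∸1≡a∸b : ∀ a b → a + 1 ∸ b ∸ 1 ≡ a ∸ b
a+1∸b∸1≡a∸b a b = trans (ℕ.∸-+-assoc (a + 1) b 1) (cong₂ _∸_ (ℕ.+-comm a 1) (ℕ.+-comm b 1))

acyclicCount-odd : ∀ j → acyclicCount (2 * suc j + 0) 1 0 ≡ oddFormula (suc j)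
acyclicCount-odd j = begin
  acyclicCount (2 * k + 0) 1 0
    ≡⟨ acyclicCount-unfold k 0 ⟩
  (P * T k ^ (3 * 2 ^ (2 * k + 0 ∸ 2 * k))) * (blockedPaths (mersenne (suc k)) * blockedPaths (mersenne k))
    ≡⟨ cong₂ (λ e x → (P * T k ^ (3 * 2 ^ e)) * x) (ℕ.m+n∸m≡n (2 * k) 0)
             (cong₂ _*_ (blockedPaths-mersenne (suc k)) (blockedPaths-mersenne k)) ⟩
  (P * T k ^ 3) * (T (suc k) * T k)
    ≡⟨ regroup P (T k) (T (suc k)) ⟩
  T k ^ 4 * T (suc k) * P
    ≡⟨ cong (T k ^ 4 * T (suc k) *_) (prod1-cong j λ i → cong (λ e → T i ^ (3 * 2 ^ e)) (exponent i)) ⟩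
  oddFormula k ∎
  where
  open ≡-Reasoning
  k P : ℕ
  k = suc j
  P = prod1 j (λ i → T i ^ (3 * 2 ^ (2 * k + 0 ∸ 2 * i)))
  regroup : ∀ a x y → (a * (x * (x * (x * 1)))) * (y * x) ≡ x * (x * (x * (x * 1))) * y * a
  regroup = solve-∀
  exponent : ∀ i → 2 * k + 0 ∸ 2 * i ≡ 2 * k + 1 ∸ 2 * i ∸ 1
  exponent i = trans (cong (_∸ 2 * i) (ℕ.+-identityʳ (2 * k))) (sym (a+1∸b∸1≡a∸b (2 * k) (2 * i)))

acyclicCount-even : ∀ j → acyclicCount (2 * j + 1) 1 0 ≡ evenFormula (suc j)
acyclicCount-even j = begin
  acyclicCount (2 * j + 1) 1 0
    ≡⟨ acyclicCount-unfold j 1 ⟩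
  P * (blockedPaths p ^ 1 * (blockedPaths (mersenne j + suc (mersenne j)) * blockedPaths p))
    ≡⟨ cong (λ q → P * (blockedPaths p ^ 1 * (blockedPaths q * blockedPaths p))) (sym (mersenne-suc j)) ⟩
  P * (blockedPaths p ^ 1 * (blockedPaths p * blockedPaths p))
    ≡⟨ cong (λ x → P * (x ^ 1 * (x * x))) (blockedPaths-mersenne k) ⟩
  P * (T k ^ 1 * (T k * T k))
    ≡⟨ regroup P (T k) ⟩
  T k ^ 3 * P
    ≡⟨ cong (T k ^ 3 *_) (prod1-cong j λ i → cong (λ e → T i ^ (3 * 2 ^ e)) (exponent i)) ⟩
  evenFormula k ∎
  where
  open ≡-Reasoning
  k p P : ℕ
  k = suc j
  p = mersenne k
  P = prod1 j (λ i → T i ^ (3 * 2 ^ (2 * j + 1 ∸ 2 * i)))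
  regroup : ∀ a x → a * ((x * 1) * (x * x)) ≡ (x * (x * (x * 1))) * a
  regroup = solve-∀
  exponent : ∀ i → 2 * j + 1 ∸ 2 * i ≡ 2 * k ∸ 2 * i ∸ 1
  exponent i = trans (sym (a+1∸b∸1≡a∸b (2 * j + 1) (2 * i))) (cong (λ m → m ∸ 2 * i ∸ 1) (2j+2≡2[j+1] j))
    where
    2j+2≡2[j+1] : ∀ j → 2 * j + 1 + 1 ≡ 2 * suc j
    2j+2≡2[j+1] = solve-∀

numAcyclic-odd : ∀ j → NumAcyclicOrientations (2 * suc j + 1) (oddFormula (suc j))
numAcyclic-odd j = subst₂ NumAcyclicOrientations (n≡ j)
  (trans (cong (λ m → acyclicCount m 1 0) (m≡ j)) (acyclicCount-odd j)) (numAcyclic-≥2 (2 * j + 1))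
  where
  n≡ : ∀ j → 2 + (2 * j + 1) ≡ 2 * suc j + 1
  n≡ = solve-∀
  m≡ : ∀ j → 1 + (2 * j + 1) ≡ 2 * suc j + 0
  m≡ = solve-∀

numAcyclic-even : ∀ j → NumAcyclicOrientations (2 * suc j) (evenFormula (suc j))
numAcyclic-even j = subst₂ NumAcyclicOrientations (n≡ j)
  (trans (cong (λ m → acyclicCount m 1 0) (m≡ j)) (acyclicCount-even j)) (numAcyclic-≥2 (2 * j))
  where
  n≡ : ∀ j → 2 + 2 * j ≡ 2 * suc j
  n≡ = solve-∀
  m≡ : ∀ j → 1 + 2 * j ≡ 2 * j + 1
  m≡ = solve-∀

-- B₁^* consists of two parallel edges between 0 and 1.
numAcyclic-1 : NumAcyclicOrientations 1 2
numAcyclic-1 = record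
  { elems    = (true ∷ false ∷ []) ∷ (false ∷ true ∷ []) ∷ []
  ; unique   = ((λ ()) All.∷ All.[]) AllPairs.∷ All.[] AllPairs.∷ AllPairs.[]
  ; complete = complete
  ; size     = refl
  }
  where
  one-way : ∀ (o : Orientation 1) a b → ¬ a ≡ b → (∀ {x y} → Arc o x y → x ≡ a × y ≡ b) → Acyclic 1 o
  one-way o a b a≢b arcs-a→b (x , c) = a≢b (trans (sym (source c)) (target c))
    where
    source : ∀ {x y} → TransClosure (Arc o) x y → x ≡ a
    source [ r ]   = proj₁ (arcs-a→b r)
    source (r ∷ _) = proj₁ (arcs-a→b r)
    target : ∀ {x y} → TransClosure (Arc o) x y → y ≡ b
    target [ r ]    = proj₂ (arcs-a→b r)
    target (_ ∷ rs) = target rs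
  complete : ∀ o → (o ∈ (true ∷ false ∷ []) ∷ (false ∷ true ∷ []) ∷ []) ⇔ Acyclic 1 o
  complete o@(true ∷ false ∷ [])  = mk⇔ (λ _ → one-way o (false ∷ []) (true ∷ []) (λ ()) both-0→1) (λ _ → here refl)
    where both-0→1 : ∀ {x y} → Arc o x y → x ≡ false ∷ [] × y ≡ true ∷ []
          both-0→1 (zero , refl)     = refl , refl
          both-0→1 (suc zero , refl) = refl , refl
  complete o@(false ∷ true ∷ [])  = mk⇔ (λ _ → one-way o (true ∷ []) (false ∷ []) (λ ()) both-1→0) (λ _ → there (here refl))
    where both-1→0 : ∀ {x y} → Arc o x y → x ≡ true ∷ [] × y ≡ false ∷ []
          both-1→0 (zero , refl)     = refl , refl
          both-1→0 (suc zero , refl) = refl , refl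
  complete (true ∷ true ∷ [])   = mk⇔ (λ { (here ()) ; (there (here ())) ; (there (there ())) })
                                      (λ acyclic → ⊥-elim (acyclic (_ , (zero , refl) ∷ [ suc zero , refl ])))
  complete (false ∷ false ∷ []) = mk⇔ (λ { (here ()) ; (there (here ())) ; (there (there ())) })
                                      (λ acyclic → ⊥-elim (acyclic (_ , (suc zero , refl) ∷ [ zero , refl ])))

mainTheorem14 : ((n : ℕ) → 4 ≤ n →
                   ((k : ℕ) → n ≡ 2 * k + 1 → NumAcyclicOrientations n (oddFormula k))
                   × ((k : ℕ) → n ≡ 2 * k → NumAcyclicOrientations n (evenFormula k)))
                × NumAcyclicOrientations 1 2
                × NumAcyclicOrientations 2 8
                × NumAcyclicOrientations 3 224
mainTheorem14 = (λ n 4≤n → odd 4≤n , even 4≤n) , numAcyclic-1 , numAcyclic-≥2 0 , numAcyclic-≥2 1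
  where
  odd : ∀ {n} → 4 ≤ n → (k : ℕ) → n ≡ 2 * k + 1 → NumAcyclicOrientations n (oddFormula k)
  odd (s≤s ()) zero refl
  odd _ (suc j) refl = numAcyclic-odd j
  even : ∀ {n} → 4 ≤ n → (k : ℕ) → n ≡ 2 * k → NumAcyclicOrientations n (evenFormula k)
  even () zero refl
  even _ (suc j) refl = numAcyclic-even j
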